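{- Let $\rho$ be a kernel permutation and $\pi\in S(\rho)$. Let $C_{ml}$ and $C_{m'l}$ be two nonempty feasible cells of the kernel cell decomposition of $\pi$ with $m<m'$. Then every entry $a\in C_{ml}$ occupies a position in $\pi$ to the right of the position of every entry $b\in C_{m'l}$.
   Context: Patterns. An occurrence of $132$ in $\pi\in S_n$ is a triple of positions $i<j<k$ with $\pi(i)<\pi(k)<\pi(j)$. The graph $G_\pi$. $G_\pi$ is the bipartite graph whose vertices are the entries of $\pi$ and the occurrences of $132$ in $\pi$. An entry is adjacent to an occurrence exactly when it is one of the three entries of that occurrence. Kernel. Let $\pi(i_1),\dots,\pi(i_s)$, with $i_1<\dots<i_s$, be the entries in the component of $G_\pi$ containing $n$. This is the kernel of $\pi$, and the permutation $\sigma_\pi\in S_s$ order-isomorphic to it is the kernel shape. Kernel permutations. $\rho$ is a kernel permutation if $\rho=\sigma_\pi$ for some $\pi$. $S(\rho)$ is the set of permutations with kernel shape $\rho$. Cells. For $\pi\in S(\rho)\cap S_n$, set $i_0=0$, $i_{s+1}=n+1$, and interpret $\pi(i_{\rho^{ -1}(0)})$ as $0$. For $1\leq m\leq s$ and $1\leq l\leq s+1$, define $$C_{ml}(\pi)=\{\pi(j): i_{l-1}<j<i_l,\ \pi(i_{\rho^{ -1}(m-1)})<\pi(j)<\pi(i_{\rho^{ -1}(m)})\}.$$ Feasibility. $C_{ml}$ is infeasible if, in $(\rho(1),\dots,\rho(l-1),m-\tfrac12,\rho(l),\dots,\rho(s))$, the inserted entry $m-\tfrac12$ belongs to some occurrence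 of $132$. Otherwise it is feasible. -}

module Defs where

open import Data.Nat using (ℕ; zero; suc; _+_; _*_)
open import Data.Fin using (Fin; toℕ; fromℕ; _<_)
open import Data.Fin.Permutation using (Permutation′; _⟨$⟩ʳ_; _⟨$⟩ˡ_)
open import Data.Vec using (Vec; tabulate; insertAt; lookup)
open import Data.Product using (Σ; ∃; _×_; _,_)
open import Data.Sum using (_⊎_)
open import Function.Bundles using (_⇔_)
open import Relation.Nullary using (¬_)
open import Relation.Binary.PropositionalEquality using (_≡_)
open import Relation.Binary.Construct.Closure.ReflexiveTransitive using (Star)

-- Conventions: positions and values are 0-based (Fin n); value k stands for
-- the paper's entry k+1.  The maximum entry n is thus fromℕ k in S_{suc k}.

Occ132 : ∀ {N} → (Fin N → ℕ) → Fin N → Fin N → Fin N → Set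
Occ132 f i j k = i < j × j < k × (f i Data.Nat.< f k) × (f k Data.Nat.< f j)

OneOf : ∀ {N} → Fin N → Fin N → Fin N → Fin N → Set
OneOf p i j k = p ≡ i ⊎ p ≡ j ⊎ p ≡ k

val : ∀ {n} → Permutation′ n → Fin n → ℕ
val π i = toℕ (π ⟨$⟩ʳ i)

-- entries at positions p and q are both in a common 132-occurrence of π
-- (adjacency in G_π through an occurrence vertex)
Linked : ∀ {n} → Permutation′ n → Fin n → Fin n → Set
Linked π p q = ∃ λ i → ∃ λ j → ∃ λ k →
  Occ132 (val π) i j k × OneOf p i j k × OneOf q i j k

-- position p carries an entry in the component of G_π containing the
-- maximal entry n (value fromℕ k, 0-based)
InKernel : ∀ {k} → Permutation′ (suc k) → Fin (suc k) → Set
InKernel {k} π p = Star (Linked π) p (π ⟨$⟩ˡ fromℕ k)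

-- ι : Fin s → Fin n enumerates the kernel positions i_1 < ... < i_s,
-- and the kernel is order-isomorphic to ρ.  (ι is unique when it exists.)
record KernelData {k s} (π : Permutation′ (suc k)) (ρ : Permutation′ s)
                  (ι : Fin s → Fin (suc k)) : Set where
  field
    increasing : ∀ a b → a < b → ι a < ι b
    image      : ∀ p → InKernel π p ⇔ (∃ λ a → ι a ≡ p)
    orderIso   : ∀ a b → (π ⟨$⟩ʳ ι a < π ⟨$⟩ʳ ι b) ⇔ (ρ ⟨$⟩ʳ a < ρ ⟨$⟩ʳ b)

InS : ∀ {s} (ρ : Permutation′ s) {k} (π : Permutation′ (suc k)) → Set
InS {s} ρ π = ∃ λ (ι : Fin s → Fin _) → KernelData π ρ ι

IsKernelPerm : ∀ {s} → Permutation′ s → Set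
IsKernelPerm ρ = ∃ λ k → ∃ λ (π : Permutation′ (suc k)) → InS ρ π

-- The entry at position j lies in the cell C_{ml} (0-based m : Fin s is the
-- paper's m+1, 0-based l : Fin (suc s) is the paper's l+1), w.r.t. the
-- kernel enumeration ι.
--   column: i_{l-1} < j < i_l   (bounds i_0 = 0, i_{s+1} = n+1 are vacuous)
--   row:    π(i_{ρ⁻¹(m-1)}) < π(j) < π(i_{ρ⁻¹(m)})  (lower bound vacuous for m=1)
InCell : ∀ {k s} (π : Permutation′ (suc k)) (ρ : Permutation′ s)
         (ι : Fin s → Fin (suc k)) → Fin s → Fin (suc s) → Fin (suc k) → Set
InCell π ρ ι m l j =
  (∀ a → suc (toℕ a) ≡ toℕ l → ι a < j) ×
  (∀ a → toℕ a ≡ toℕ l → j < ι a) ×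
  (∀ a → suc (toℕ (ρ ⟨$⟩ʳ a)) ≡ toℕ m → π ⟨$⟩ʳ ι a < π ⟨$⟩ʳ j) ×
  (∀ a → ρ ⟨$⟩ʳ a ≡ m → π ⟨$⟩ʳ j < π ⟨$⟩ʳ ι a)

-- The word (ρ(1),…,ρ(l-1), m-1/2, ρ(l),…,ρ(s)), with all values doubled to
-- stay in ℕ: the paper's ρ-value r becomes 2r, and m - 1/2 becomes 2m-1.
insertedWord : ∀ {s} → Permutation′ s → Fin s → Fin (suc s) → Fin (suc s) → ℕ
insertedWord ρ m l =
  lookup (insertAt (tabulate (λ a → 2 * toℕ (ρ ⟨$⟩ʳ a) + 2)) l (2 * toℕ m + 1))

Feasible : ∀ {s} → Permutation′ s → Fin s → Fin (suc s) → Set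
Feasible ρ m l = ¬ (∃ λ i → ∃ λ j → ∃ λ k →
  Occ132 (insertedWord ρ m l) i j k × OneOf l i j k)

module Submission where

open import Defs
open import Data.Nat using (ℕ; suc)
open import Data.Fin using (Fin; _<_)
open import Data.Fin.Permutation using (Permutation′)
open import Data.Product using (∃; _×_)

open import Data.Nat as ℕ using (z≤n; s≤s; _*_; _+_)
open import Data.Nat.Properties
open import Data.Fin as Fin using (toℕ; fromℕ; fromℕ<; punchIn; inject₁)
open import Data.Fin.Properties as Finₚ using (toℕ-injective; toℕ<n; toℕ-fromℕ<; toℕ-fromℕ; toℕ-inject₁)
open import Data.Fin.Permutation using (_⟨$⟩ʳ_; _⟨$⟩ˡ_; inverseʳ)
open import Data.Vec.Properties using (insertAt-punchIn; insertAt-lookup; lookup∘tabulate)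
open import Data.Product using (_,_; proj₁; proj₂)
open import Data.Sum using (_⊎_; inj₁; inj₂)
open import Data.Empty using (⊥; ⊥-elim)
open import Function using (_∘_; id)
open import Function.Bundles using (Equivalence)
open import Relation.Nullary using (¬_; yes; no)
open import Relation.Binary using (tri<; tri≈; tri>)
open import Relation.Binary.PropositionalEquality
open import Relation.Binary.Construct.Closure.ReflexiveTransitive using (Star; ε; _◅_; fold)

-- Let x be the kernel entry of ρ-value m bounding C_{ml} from
-- above.  Feasibility of both cells makes the kernel entries left of column l
-- with ρ-value in [m, m′) closed under 132-occurrences; as the kernel is
-- connected and its maximum has ρ-value ≥ m′, x lies right of column l.  If
-- a ∈ C_{ml} stood left of b ∈ C_{m′l}, then a, b, x would form a 132, putting
-- a into the kernel, which no cell entry is.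

even<odd : ∀ {a m} → a ℕ.< m → 2 * a + 2 ℕ.< 2 * m + 1
even<odd {a} {m} a<m = begin-strict
  2 * a + 2   ≡⟨ +-comm (2 * a) 2 ⟩
  2 + 2 * a   ≡⟨ *-suc 2 a ⟨
  2 * suc a   ≤⟨ *-monoʳ-≤ 2 a<m ⟩
  2 * m       <⟨ n<1+n (2 * m) ⟩
  suc (2 * m) ≡⟨ +-comm 1 (2 * m) ⟩
  2 * m + 1   ∎
  where open ≤-Reasoning

odd<even : ∀ {m b} → m ℕ.≤ b → 2 * m + 1 ℕ.< 2 * b + 2
odd<even m≤b = +-mono-≤-< (*-monoʳ-≤ 2 m≤b) (s≤s (s≤s z≤n))

even<even : ∀ {a b} → a ℕ.< b → 2 * a + 2 ℕ.< 2 * b + 2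
even<even a<b = +-monoˡ-< 2 (*-monoʳ-< 2 a<b)

toℕ-punchIn-< : ∀ {n} (i : Fin (suc n)) (j : Fin n) → toℕ j ℕ.< toℕ i → toℕ (punchIn i j) ≡ toℕ j
toℕ-punchIn-< (Fin.suc i) Fin.zero    _         = refl
toℕ-punchIn-< (Fin.suc i) (Fin.suc j) (s≤s j<i) = cong suc (toℕ-punchIn-< i j j<i)

toℕ-punchIn-≥ : ∀ {n} (i : Fin (suc n)) (j : Fin n) → toℕ i ℕ.≤ toℕ j → toℕ (punchIn i j) ≡ suc (toℕ j)
toℕ-punchIn-≥ Fin.zero    j           _         = refl
toℕ-punchIn-≥ (Fin.suc i) (Fin.suc j) (s≤s i≤j) = cong suc (toℕ-punchIn-≥ i j i≤j)

star-preserves : ∀ {a} {A : Set a} {R : A → A → Set} (P : A → Set) →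
                 (∀ {x y} → R x y → P x → P y) → ∀ {x y} → Star R x y → P x → P y
star-preserves P preserves = fold (λ x y → P x → P y) (λ r k → k ∘ preserves r) id

module InsertedWord {s} (ρ : Permutation′ s) (m : Fin s) (l : Fin (suc s)) where

  insertedWord-punchIn : ∀ a → insertedWord ρ m l (punchIn l a) ≡ 2 * val ρ a + 2
  insertedWord-punchIn a = trans (insertAt-punchIn _ l _ a) (lookup∘tabulate _ a)

  insertedWord-at : insertedWord ρ m l l ≡ 2 * toℕ m + 1
  insertedWord-at = insertAt-lookup _ l _

  -- insertion-not-the-i: the inserted entry m − ½ plays no role i
  -- (1 smallest, 3 largest) in an occurrence of 132.
  module _ (feasible : Feasible ρ m l) where

    insertion-not-the-2 : ∀ {a b} → a < b → toℕ b ℕ.< toℕ l →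
                          val ρ a ℕ.< toℕ m → toℕ m ℕ.≤ val ρ b → ⊥
    insertion-not-the-2 {a} {b} a<b b<l a<m m≤b =
      feasible (punchIn l a , punchIn l b , l , occ , inj₂ (inj₂ refl))
      where
      pa = sym (toℕ-punchIn-< l a (<-trans a<b b<l))
      pb = sym (toℕ-punchIn-< l b b<l)
      occ : Occ132 (insertedWord ρ m l) (punchIn l a) (punchIn l b) l
      occ = subst₂ ℕ._<_ pa pb a<b
          , subst (ℕ._< toℕ l) pb b<l
          , subst₂ ℕ._<_ (sym (insertedWord-punchIn a)) (sym insertedWord-at) (even<odd a<m)
          , subst₂ ℕ._<_ (sym insertedWord-at) (sym (insertedWord-punchIn b)) (odd<even m≤b)

    insertion-not-the-1 : ∀ {b c} → toℕ l ℕ.≤ toℕ b → b < c →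
                          toℕ m ℕ.≤ val ρ c → val ρ c ℕ.< val ρ b → ⊥
    insertion-not-the-1 {b} {c} l≤b b<c m≤c c<b =
      feasible (l , punchIn l b , punchIn l c , occ , inj₁ refl)
      where
      pb = sym (toℕ-punchIn-≥ l b l≤b)
      pc = sym (toℕ-punchIn-≥ l c (≤-trans l≤b (<⇒≤ b<c)))
      occ : Occ132 (insertedWord ρ m l) l (punchIn l b) (punchIn l c)
      occ = subst (toℕ l ℕ.<_) pb (s≤s l≤b)
          , subst₂ ℕ._<_ pb pc (s≤s b<c)
          , subst₂ ℕ._<_ (sym insertedWord-at) (sym (insertedWord-punchIn c)) (odd<even m≤c)
          , subst₂ ℕ._<_ (sym (insertedWord-punchIn c)) (sym (insertedWord-punchIn b)) (even<even c<b)

    insertion-not-the-3 : ∀ {a c} → toℕ a ℕ.< toℕ l → toℕ l ℕ.≤ toℕ c →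
                          val ρ a ℕ.< val ρ c → val ρ c ℕ.< toℕ m → ⊥
    insertion-not-the-3 {a} {c} a<l l≤c a<c c<m =
      feasible (punchIn l a , l , punchIn l c , occ , inj₂ (inj₁ refl))
      where
      occ : Occ132 (insertedWord ρ m l) (punchIn l a) l (punchIn l c)
      occ = subst (ℕ._< toℕ l) (sym (toℕ-punchIn-< l a a<l)) a<l
          , subst (toℕ l ℕ.<_) (sym (toℕ-punchIn-≥ l c l≤c)) (s≤s l≤c)
          , subst₂ ℕ._<_ (sym (insertedWord-punchIn a)) (sym (insertedWord-punchIn c)) (even<even a<c)
          , subst₂ ℕ._<_ (sym (insertedWord-punchIn c)) (sym insertedWord-at) (even<odd c<m)

module Band {s} (ρ : Permutation′ s) (l : Fin (suc s)) (m m′ : Fin s)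
            (feasible : Feasible ρ m l) (feasible′ : Feasible ρ m′ l) where
  open InsertedWord ρ m l using (insertion-not-the-1; insertion-not-the-2)
  open InsertedWord ρ m′ l using (insertion-not-the-3)
    renaming (insertion-not-the-2 to insertion′-not-the-2)

  InBand : Fin s → Set
  InBand a = toℕ a ℕ.< toℕ l × toℕ m ℕ.≤ val ρ a × val ρ a ℕ.< toℕ m′

  module _ {a b c} (occ : Occ132 (val ρ) a b c) where
    private
      a<b = proj₁ occ
      b<c = proj₁ (proj₂ occ)
      a<c = proj₁ (proj₂ (proj₂ occ))
      c<b = proj₂ (proj₂ (proj₂ occ))

      a<2or3 : ∀ {x} → x ≡ b ⊎ x ≡ c → a < x × val ρ a ℕ.< val ρ x
      a<2or3 (inj₁ refl) = a<b , <-trans a<c c<b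
      a<2or3 (inj₂ refl) = <-trans a<b b<c , a<c

    band-from-1 : InBand a → InBand b × InBand c
    band-from-1 (a<l , m≤a , a<m′) with toℕ b ℕ.<? toℕ l
    ... | no b≮l = ⊥-elim (insertion-not-the-1 feasible (≮⇒≥ b≮l) b<c (≤-trans m≤a (<⇒≤ a<c)) c<b)
    ... | yes b<l with val ρ b ℕ.<? toℕ m′
    ... | no b≮m′ = ⊥-elim (insertion′-not-the-2 feasible′ a<b b<l a<m′ (≮⇒≥ b≮m′))
    ... | yes b<m′ with toℕ c ℕ.<? toℕ l
    ... | no c≮l = ⊥-elim (insertion-not-the-3 feasible′ a<l (≮⇒≥ c≮l) a<c (<-trans c<b b<m′))
    ... | yes c<l = (b<l , ≤-trans m≤a (<⇒≤ (<-trans a<c c<b)) , b<m′)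
                  , (c<l , ≤-trans m≤a (<⇒≤ a<c) , <-trans c<b b<m′)

    band-to-1 : ∀ {x} → OneOf x a b c → InBand x → InBand a
    band-to-1 (inj₁ refl) inBand = inBand
    band-to-1 (inj₂ x∈bc) (x<l , m≤x , x<m′) with a<2or3 x∈bc | val ρ a ℕ.<? toℕ m
    ... | a<x , _     | yes a<m = ⊥-elim (insertion-not-the-2 feasible a<x x<l a<m m≤x)
    ... | a<x , ρa<ρx | no a≮m  = <-trans a<x x<l , ≮⇒≥ a≮m , <-trans ρa<ρx x<m′

  band-closed : ∀ {x y} → Linked ρ x y → InBand x → InBand y
  band-closed (a , b , c , occ , x∈ , y∈) inBand with band-to-1 occ x∈ inBand
  ... | a∈band with y∈
  ... | inj₁ refl        = a∈band
  ... | inj₂ (inj₁ refl) = proj₁ (band-from-1 occ a∈band)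
  ... | inj₂ (inj₂ refl) = proj₂ (band-from-1 occ a∈band)

val-inverse : ∀ {n} (ρ : Permutation′ n) (m : Fin n) → val ρ (ρ ⟨$⟩ˡ m) ≡ toℕ m
val-inverse ρ m = cong toℕ (inverseʳ ρ)

module Kernel {s k} (ρ : Permutation′ s) (π : Permutation′ (suc k))
              (ι : Fin s → Fin (suc k)) (kernel : KernelData π ρ ι) where
  open KernelData kernel

  ι-mono-≤ : ∀ {a b} → a Fin.≤ b → ι a Fin.≤ ι b
  ι-mono-≤ {a} {b} a≤b with m≤n⇒m<n∨m≡n a≤b
  ... | inj₁ a<b = <⇒≤ (increasing a b a<b)
  ... | inj₂ a≡b = ≤-reflexive (cong (toℕ ∘ ι) (toℕ-injective a≡b))

  ι-injective : ∀ {a b} → ι a ≡ ι b → a ≡ b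
  ι-injective {a} {b} ιa≡ιb with Finₚ.<-cmp a b
  ... | tri< a<b _ _ = ⊥-elim (Finₚ.<⇒≢ (increasing a b a<b) ιa≡ιb)
  ... | tri≈ _ a≡b _ = a≡b
  ... | tri> _ _ b<a = ⊥-elim (Finₚ.<⇒≢ (increasing b a b<a) (sym ιa≡ιb))

  ι-cancel-< : ∀ {a b} → ι a < ι b → a < b
  ι-cancel-< ιa<ιb = ≰⇒> (λ b≤a → <⇒≱ ιa<ιb (ι-mono-≤ b≤a))

  ι-inKernel : ∀ a → InKernel π (ι a)
  ι-inKernel a = Equivalence.from (image (ι a)) (a , refl)

  kernel-index : ∀ {p} → InKernel π p → ∃ λ a → ι a ≡ p
  kernel-index {p} = Equivalence.to (image p)

  val-mono-≤ : ∀ {a b} → val ρ a ℕ.≤ val ρ b → val π (ι a) ℕ.≤ val π (ι b)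
  val-mono-≤ {a} {b} ρa≤ρb = ≮⇒≥ (λ ιb<ιa → <⇒≱ (Equivalence.to (orderIso b a) ιb<ιa) ρa≤ρb)

  occurrence-inKernel : ∀ {i j t p q} → Occ132 (val π) i j t → OneOf q i j t → InKernel π q →
                        OneOf p i j t → InKernel π p
  occurrence-inKernel occ q∈ q∈kernel p∈ = (_ , _ , _ , occ , p∈ , q∈) ◅ q∈kernel

  linked-reflect : ∀ {a b} → Linked π (ι a) (ι b) → Linked ρ a b
  linked-reflect {a} {b} (i , j , t , occ@(i<j , j<t , πi<πt , πt<πj) , a∈ , b∈)
    with kernel-index (inKernel (inj₁ refl)) | kernel-index (inKernel (inj₂ (inj₁ refl)))
       | kernel-index (inKernel (inj₂ (inj₂ refl)))
    where
    inKernel : ∀ {p} → OneOf p i j t → InKernel π p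
    inKernel = occurrence-inKernel occ b∈ (ι-inKernel b)
  ... | a₁ , refl | b₁ , refl | c₁ , refl =
    a₁ , b₁ , c₁
    , (ι-cancel-< i<j , ι-cancel-< j<t , Equivalence.to (orderIso a₁ c₁) πi<πt , Equivalence.to (orderIso c₁ b₁) πt<πj)
    , reflect a∈ , reflect b∈
    where
    reflect : ∀ {x} → OneOf (ι x) (ι a₁) (ι b₁) (ι c₁) → OneOf x a₁ b₁ c₁
    reflect (inj₁ e)        = inj₁ (ι-injective e)
    reflect (inj₂ (inj₁ e)) = inj₂ (inj₁ (ι-injective e))
    reflect (inj₂ (inj₂ e)) = inj₂ (inj₂ (ι-injective e))

  top : Fin s
  top = proj₁ (kernel-index ε)

  top-maximal : ∀ b → val ρ b ℕ.≤ val ρ top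
  top-maximal b = ≮⇒≥ (λ top<b → <⇒≱ (Equivalence.from (orderIso top b) top<b) (val-≤-k (ι b)))
    where
    val-≤-k : ∀ p → val π p ℕ.≤ val π (ι top)
    val-≤-k p rewrite proj₂ (kernel-index ε) | inverseʳ π {fromℕ k} | toℕ-fromℕ k =
      ≤-pred (toℕ<n (π ⟨$⟩ʳ p))

  kernel-connected : ∀ a → Star (Linked ρ) a top
  kernel-connected a = go (ι-inKernel a) refl
    where
    go : ∀ {p a} → InKernel π p → ι a ≡ p → Star (Linked ρ) a top
    go ε ιa≡top = subst (Star (Linked ρ) _) (ι-injective (trans ιa≡top (sym (proj₂ (kernel-index ε))))) ε
    go (lk ◅ path) refl with kernel-index path
    ... | b , refl = linked-reflect lk ◅ go path refl

  cell-left : ∀ {m l j a} → InCell π ρ ι m l j → toℕ a ℕ.< toℕ l → ι a < j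
  cell-left {l = Fin.suc l′} (left , _) a<l = ≤-<-trans (ι-mono-≤ (≤-pred a<l)) (left l′ refl)

  cell-right : ∀ {m l j a} → InCell π ρ ι m l j → toℕ l ℕ.≤ toℕ a → j < ι a
  cell-right {a = a} (_ , right , _) l≤a = <-≤-trans (right l′ (toℕ-fromℕ< l<s)) (ι-mono-≤ l′≤a)
    where
    l<s = ≤-<-trans l≤a (toℕ<n a)
    l′ = fromℕ< l<s
    l′≤a : l′ Fin.≤ a
    l′≤a = subst (ℕ._≤ toℕ a) (sym (toℕ-fromℕ< l<s)) l≤a

  cell-disjoint-kernel : ∀ {m l j} → InCell π ρ ι m l j → ¬ InKernel π j
  cell-disjoint-kernel {l = l} cell inKernel with kernel-index inKernel
  ... | a , refl with toℕ a ℕ.<? toℕ l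
  ... | yes a<l = <-irrefl refl (cell-left cell a<l)
  ... | no a≮l  = <-irrefl refl (cell-right cell (≮⇒≥ a≮l))

  cell-above-row : ∀ {m l j a} → InCell π ρ ι m l j → val ρ a ℕ.< toℕ m → val π (ι a) ℕ.< val π j
  cell-above-row {m = Fin.suc p} {a = a} (_ , _ , above , _) a<m =
    ≤-<-trans (val-mono-≤ a≤y) (above y (cong suc (trans (val-inverse ρ (inject₁ p)) (toℕ-inject₁ p))))
    where
    y = ρ ⟨$⟩ˡ inject₁ p
    a≤y : val ρ a ℕ.≤ val ρ y
    a≤y rewrite val-inverse ρ (inject₁ p) | toℕ-inject₁ p = ≤-pred a<m

  upper-corner-right-of-column : ∀ {m m′ l} → Feasible ρ m l → Feasible ρ m′ l → m < m′ →
                                 toℕ l ℕ.≤ toℕ (ρ ⟨$⟩ˡ m)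
  upper-corner-right-of-column {m} {m′} {l} feasible feasible′ m<m′ = ≮⇒≥ λ x<l →
    let top∈band = star-preserves InBand band-closed (kernel-connected x) (x<l , m≤x , x<m′)
    in <⇒≱ (proj₂ (proj₂ top∈band)) (subst (ℕ._≤ val ρ top) (val-inverse ρ m′) (top-maximal (ρ ⟨$⟩ˡ m′)))
    where
    open Band ρ l m m′ feasible feasible′
    x = ρ ⟨$⟩ˡ m
    m≤x = ≤-reflexive (sym (val-inverse ρ m))
    x<m′ = subst (ℕ._< toℕ m′) (sym (val-inverse ρ m)) m<m′

lemma5 : ∀ {s k} (ρ : Permutation′ s) (π : Permutation′ (suc k))
    → IsKernelPerm ρ
    → (ι : Fin s → Fin (suc k)) → KernelData π ρ ι
    → (m m′ : Fin s) (l : Fin (suc s))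
    → Feasible ρ m l → Feasible ρ m′ l
    → (∃ λ j → InCell π ρ ι m l j) → (∃ λ j → InCell π ρ ι m′ l j)
    → m < m′
    → ∀ ja jb → InCell π ρ ι m l ja → InCell π ρ ι m′ l jb → jb < ja
lemma5 ρ π _ ι kernel m m′ l feasible feasible′ _ _ m<m′ ja jb cellA cellB = ≰⇒> ja≰jb
  where
  open Kernel ρ π ι kernel
  x = ρ ⟨$⟩ˡ m
  ja<x : val π ja ℕ.< val π (ι x)
  ja<x = proj₂ (proj₂ (proj₂ cellA)) x (inverseʳ ρ)
  x<jb : val π (ι x) ℕ.< val π jb
  x<jb = cell-above-row cellB (subst (ℕ._< toℕ m′) (sym (val-inverse ρ m)) m<m′)
  jb<x : jb < ι x
  jb<x = cell-right cellB (upper-corner-right-of-column feasible feasible′ m<m′)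
  ja≰jb : ¬ ja Fin.≤ jb
  ja≰jb ja≤jb with m≤n⇒m<n∨m≡n ja≤jb
  ... | inj₁ ja<jb = cell-disjoint-kernel cellA (occurrence ◅ ι-inKernel x)
    where
    occurrence : Linked π ja (ι x)
    occurrence = ja , jb , ι x , (ja<jb , jb<x , ja<x , x<jb) , inj₁ refl , inj₂ (inj₂ refl)
  ... | inj₂ ja≡jb = <-irrefl (cong (val π) (toℕ-injective ja≡jb)) (<-trans ja<x x<jb)
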